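{- Let $m,n$ be integers with $n\ge 3$ and $m-n\ge 1$, and let $G$, $P$, $S$ and $\mu:S\to P\setminus S$ be as defined in the context. Then $\mu$ is an acyclic matching on $P$.
   Context: $[k]=\{1,\dots,k\}$. Let $G$ be the graph whose vertices are the maps $f:[n]\to[m]$ that are either constant or injective, with $f\sim f'$ iff $f(i)\ne f'(j)$ for all $i\ne j$ in $[n]$ (the induced subgraph of the exponential graph $K_m^{K_n}$; injective maps have loops). The constant map with value $x$ is denoted $\langle x\rangle$. The neighbourhood complex $\mathcal N(G)$ is the simplicial complex whose simplices are the nonempty sets of vertices of $G$ having a common neighbour in $G$. Let $P$ be the set of its (nonempty) simplices ordered by inclusion; for $\alpha,\beta\in P$ write $\beta\succ\alpha$ if $\alpha\subset\beta$ and $|\beta|=|\alpha|+1$. Define $S_1=\{\sigma\in P:\langle 1\rangle\notin\sigma,\ \sigma\cup\{\langle1\rangle\}\in P\}$, $\mu_1(\sigma)=\sigma\cup\{\langle1\rangle\}$, and $S_1'=P\setminus(S_1\cup\mu_1(S_1))$. For $2\le i\le m$ inductively define $S_i=\{\sigma\in S_{i-1}':\langle i\rangle\notin\sigma,\ \sigma\cup\{\langle i\rangle\}\in S'_{i-1}\}$, $\mu_i(\sigma)=\sigma\cup\{\langle i\rangle\}$, and $S_i'=S_{i-1}'\setminus(S_i\cup\mu_i(S_i))$. Let $S=\bigcup_{i=1}^m S_i$ (a disjoint union) and $\mu(\sigma)=\mu_i(\sigma)$ for $\sigma\in S_i$. A partial matching on $P$ is given by a subset $A\subseteq P$ and an injective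 map $\nu:A\to P\setminus A$ with $\nu(x)\succ x$ for all $x\in A$; it is acyclic if there is no sequence of distinct $x_1,\dots,x_t\in A$, $t\ge2$, with $\nu(x_i)\succ x_{i+1}$ for $1\le i<t$ and $\nu(x_t)\succ x_1$. -}

module Defs where

open import Data.Nat using (ℕ; zero; suc; _∸_; _<_; _≤_)
open import Data.Fin using (Fin; toℕ)
open import Data.Fin.Properties using () renaming (_≟_ to _≟ᶠ_)
open import Data.Bool using (Bool; true; false; _∨_)
open import Data.List using (List; []; _∷_; length; filter; concatMap; map; allFin; take; foldl)
open import Data.Vec using (Vec; []; _∷_; lookup; replicate)
open import Data.Vec.Properties using (≡-dec)
open import Data.Product using (Σ; ∃; _×_; _,_)
open import Data.Sum using (_⊎_)
open import Relation.Nullary using (¬_; Dec; does)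
open import Relation.Binary.PropositionalEquality using (_≡_; _≢_)
open import Relation.Unary using () renaming (Decidable to DecidableU)

-- A map f : [n] → [m] is represented by the vector (f 1, …, f n) : Vec (Fin m) n
-- (Fin m = {0,…,m-1} stands for [m] = {1,…,m}; value k ∈ Fin m ↔ k+1 ∈ [m]).
module _ (m n : ℕ) where

  Map : Set
  Map = Vec (Fin m) n

  _≟ᵥ_ : (u v : Map) → Dec (u ≡ v)
  _≟ᵥ_ = ≡-dec _≟ᶠ_

  IsConstant : Map → Set
  IsConstant f = ∀ i j → lookup f i ≡ lookup f j

  IsInjective : Map → Set
  IsInjective f = ∀ i j → lookup f i ≡ lookup f j → i ≡ j

  IsVertex : Map → Set
  IsVertex f = IsConstant f ⊎ IsInjective f

  Adj : Map → Map → Set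
  Adj f f' = ∀ i j → i ≢ j → lookup f i ≢ lookup f' j

  const⟨_⟩ : Fin m → Map
  const⟨ x ⟩ = replicate n x

  VSet : Set
  VSet = Map → Bool

  _∈ₛ_ : Map → VSet → Set
  v ∈ₛ σ = σ v ≡ true

  _≈ₛ_ : VSet → VSet → Set
  σ ≈ₛ τ = ∀ v → σ v ≡ τ v

  _⊆ₛ_ : VSet → VSet → Set
  σ ⊆ₛ τ = ∀ v → v ∈ₛ σ → v ∈ₛ τ

  insert : Map → VSet → VSet
  insert v σ w = σ w ∨ does (w ≟ᵥ v)

  allVecs : (k : ℕ) → List (Vec (Fin m) k)
  allVecs zero = [] ∷ []
  allVecs (suc k) = concatMap (λ x → map (x ∷_) (allVecs k)) (allFin m)

  card : VSet → ℕ
  card σ = length (filter (λ v → σ v Data.Bool.≟ true) (allVecs n))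

  _≻_ : VSet → VSet → Set
  β ≻ α = α ⊆ₛ β × card β ≡ suc (card α)

  -- P : nonempty simplices of the neighbourhood complex N(G)
  InP : VSet → Set
  InP σ = (∀ v → v ∈ₛ σ → IsVertex v)
        × (∃ λ v → v ∈ₛ σ)
        × (∃ λ w → IsVertex w × (∀ v → v ∈ₛ σ → Adj v w))

  -- given the previous layer S'_{i-1} (L) and the value x = i, the set S_i
  stepS : (VSet → Set) → Fin m → VSet → Set
  stepS L x σ = L σ × ¬ (const⟨ x ⟩ ∈ₛ σ) × L (insert const⟨ x ⟩ σ)

  stepS' : (VSet → Set) → Fin m → VSet → Set
  stepS' L x τ = L τ × ¬ stepS L x τ
               × ¬ (∃ λ σ → stepS L x σ × (τ ≈ₛ insert const⟨ x ⟩ σ))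

  layer : List (Fin m) → VSet → Set
  layer = foldl stepS' InP

  -- S_i for the value i : Fin m (i.e. the paper's S_{toℕ i + 1})
  Sᵢ : Fin m → VSet → Set
  Sᵢ i = stepS (layer (take (toℕ i) (allFin m))) i

  InS : VSet → Set
  InS σ = ∃ λ i → Sᵢ i σ

  record SElt : Set where
    constructor selt
    field
      idx : Fin m
      set : VSet
      isS : Sᵢ idx set
  open SElt public

  μ : SElt → VSet
  μ e = insert const⟨ idx e ⟩ (set e)

  IsPartialMatching : Set
  IsPartialMatching =
      (∀ e → InP (set e))
    × (∀ e → InP (μ e) × ¬ InS (μ e) × (μ e ≻ set e))
    × (∀ e e' → set e ≈ₛ set e' → idx e ≡ idx e')
    × (∀ e e' → μ e ≈ₛ μ e' → set e ≈ₛ set e')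

  IsAcyclic : Set
  IsAcyclic = ∀ (t : ℕ) → 2 ≤ t → (x : Fin t → SElt) →
      (∀ k k' → k ≢ k' → ¬ (set (x k) ≈ₛ set (x k'))) →
      (∀ k k' → toℕ k' ≡ suc (toℕ k) → μ (x k) ≻ set (x k')) →
      ¬ (∀ k k' → toℕ k ≡ t ∸ 1 → toℕ k' ≡ 0 → μ (x k) ≻ set (x k'))

-- S_i pairs each σ with σ ∪ {⟨i⟩} among the simplices that survive S_1, …, S_{i-1};
-- since every layer S'_i only removes simplices, an element of S_i or of μ(S_i) lies in
-- no later layer, which makes μ a well-defined injective matching into P \ S.
-- For acyclicity, let ⟨i⟩ have the smallest index i among the members of a putative
-- cycle x_1, …, x_t, say x_k ∈ S_i. A step μ(x) ≻ y with y ≠ x forces ⟨i⟩ ∈ y when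
-- x ∈ S_i; and ⟨i⟩ is never lost along a step μ(x) ≻ y between elements of S_j, S_{j'}
-- with j, j' ≥ i, for otherwise y would belong to S_i with μ_i(y) = μ(x), and μ(x)
-- would not have survived to layer j. Going once around the cycle from x_{k+1} puts
-- ⟨i⟩ into x_k ∈ S_i, which is impossible.
module Submission where

open import Data.Bool using (Bool; true; false; _∨_; _∧_) renaming (_≟_ to _≟ᵇ_)
open import Data.Bool.Properties using (not-¬; ∨-zeroʳ; ∨-identityʳ)
open import Data.Empty using (⊥-elim)
open import Data.Fin using (Fin; zero; suc; toℕ; inject₁; fromℕ)
open import Data.Fin.Properties using (_≟_; <-cmp; toℕ-injective; toℕ-inject₁; toℕ-fromℕ)
open import Data.List using (List; []; _∷_; _++_; map; concatMap; filter; length; allFin; take; drop; foldl)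
open import Data.List.Extrema.Nat using (argmin; f[argmin]≤f[xs])
open import Data.List.Membership.Propositional.Properties using (∈-allFin)
open import Data.List.Properties using (map-tabulate; foldl-++; take++drop≡id; take-take; take-suc-tabulate)
import Data.List.Relation.Unary.All as All
open import Data.Nat using (ℕ; zero; suc; _+_; _*_; _≤_; _<_; z≤n; s≤s)
open import Data.Nat.Properties
  using (m≤n⇒m≤1+n; +-suc; +-comm; suc-injective; ≤-reflexive; n≮n; m≤n⇒m⊓n≡m; m≤n⇒m<n∨m≡n; 1+n≢n; module ≤-Reasoning)
open import Data.Product using (∃; _×_; _,_; proj₁; proj₂; uncurry)
open import Data.Sum using (_⊎_; inj₁; inj₂; [_,_]′)
open import Data.Vec using (Vec; []; _∷_)
open import Data.Vec.Properties using (≡-dec)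
open import Function using (_∘_; id)
open import Relation.Binary.Definitions using (_Respects_; tri<; tri≈; tri>)
open import Relation.Binary.PropositionalEquality
  using (_≡_; _≢_; refl; sym; trans; cong; cong₂; subst; _≗_; module ≡-Reasoning)
open import Relation.Nullary using (¬_; does; yes; no)
open import Relation.Nullary.Decidable using (dec-true; dec-false)

open import Defs

-- card m n σ is definitionally countᵇ σ (allVecs m n n).
countᵇ : {A : Set} → (A → Bool) → List A → ℕ
countᵇ σ xs = length (filter (λ v → σ v ≟ᵇ true) xs)

module _ {A : Set} where

  countᵇ-false : {σ : A → Bool} → (∀ v → σ v ≡ false) → ∀ xs → countᵇ σ xs ≡ 0
  countᵇ-false σ≗false [] = refl
  countᵇ-false {σ} σ≗false (x ∷ xs) rewrite σ≗false x = countᵇ-false σ≗false xs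

  countᵇ-mono : {σ τ : A → Bool} → (∀ v → σ v ≡ true → τ v ≡ true) →
                ∀ xs → countᵇ σ xs ≤ countᵇ τ xs
  countᵇ-mono σ⊆τ [] = z≤n
  countᵇ-mono {σ} {τ} σ⊆τ (x ∷ xs) with σ x in σx | τ x in τx
  ... | true  | true  = s≤s (countᵇ-mono σ⊆τ xs)
  ... | true  | false with () ← trans (sym (σ⊆τ x σx)) τx
  ... | false | true  = m≤n⇒m≤1+n (countᵇ-mono σ⊆τ xs)
  ... | false | false = countᵇ-mono σ⊆τ xs

  countᵇ-∨ : {σ τ : A → Bool} → (∀ v → σ v ≡ true → τ v ≡ false) →
             ∀ xs → countᵇ (λ v → σ v ∨ τ v) xs ≡ countᵇ σ xs + countᵇ τ xs
  countᵇ-∨ disjoint [] = refl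
  countᵇ-∨ {σ} {τ} disjoint (x ∷ xs) with σ x in σx | τ x in τx
  ... | true  | true  with () ← trans (sym (disjoint x σx)) τx
  ... | true  | false = cong suc (countᵇ-∨ disjoint xs)
  ... | false | true  = trans (cong suc (countᵇ-∨ disjoint xs)) (sym (+-suc _ _))
  ... | false | false = countᵇ-∨ disjoint xs

  countᵇ-++ : (σ : A → Bool) (xs ys : List A) → countᵇ σ (xs ++ ys) ≡ countᵇ σ xs + countᵇ σ ys
  countᵇ-++ σ [] ys = refl
  countᵇ-++ σ (x ∷ xs) ys with σ x
  ... | true  = cong suc (countᵇ-++ σ xs ys)
  ... | false = countᵇ-++ σ xs ys

  countᵇ-map : {B : Set} (σ : A → Bool) (g : B → A) (xs : List B) →
               countᵇ σ (map g xs) ≡ countᵇ (σ ∘ g) xs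
  countᵇ-map σ g [] = refl
  countᵇ-map σ g (x ∷ xs) with σ (g x)
  ... | true  = cong suc (countᵇ-map σ g xs)
  ... | false = countᵇ-map σ g xs

count-≡-allFin : ∀ {m} (x : Fin m) → countᵇ (λ y → does (y ≟ x)) (allFin m) ≡ 1
count-≡-allFin {suc m} zero rewrite sym (map-tabulate id (Fin.suc {m})) =
  cong suc (trans (countᵇ-map _ suc (allFin m)) (countᵇ-false (λ _ → refl) (allFin m)))
count-≡-allFin {suc m} (suc x) rewrite sym (map-tabulate id (Fin.suc {m})) =
  trans (countᵇ-map _ suc (allFin m)) (count-≡-allFin x)

module _ {m : ℕ} where

  singleton : ∀ {k} → Vec (Fin m) k → Vec (Fin m) k → Bool
  singleton v w = does (≡-dec _≟_ w v)

  count-singleton-concatMap-∷ : ∀ {k} (x : Fin m) (v : Vec (Fin m) k) (L : List (Vec (Fin m) k)) (ys : List (Fin m)) →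
    countᵇ (singleton (x ∷ v)) (concatMap (λ y → map (y ∷_) L) ys)
      ≡ countᵇ (λ y → does (y ≟ x)) ys * countᵇ (singleton v) L
  count-singleton-concatMap-∷ x v L [] = refl
  count-singleton-concatMap-∷ x v L (y ∷ ys) = begin
    countᵇ (singleton (x ∷ v)) (map (y ∷_) L ++ concatMap _ ys)
      ≡⟨ countᵇ-++ (singleton (x ∷ v)) (map (y ∷_) L) _ ⟩
    countᵇ (singleton (x ∷ v)) (map (y ∷_) L) + countᵇ (singleton (x ∷ v)) (concatMap _ ys)
      ≡⟨ cong₂ _+_ (countᵇ-map (singleton (x ∷ v)) (y ∷_) L) (count-singleton-concatMap-∷ x v L ys) ⟩
    countᵇ (λ w → does (y ≟ x) ∧ singleton v w) L + countᵇ ≡x ys * countᵇ (singleton v) L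
      ≡⟨ head-summand ⟩
    countᵇ ≡x (y ∷ ys) * countᵇ (singleton v) L ∎
    where
    open ≡-Reasoning
    ≡x : Fin m → Bool
    ≡x z = does (z ≟ x)
    head-summand : countᵇ (λ w → does (y ≟ x) ∧ singleton v w) L + countᵇ ≡x ys * countᵇ (singleton v) L
                 ≡ countᵇ ≡x (y ∷ ys) * countᵇ (singleton v) L
    head-summand with y ≟ x
    ... | yes _ = refl
    ... | no _  = cong (_+ countᵇ ≡x ys * countᵇ (singleton v) L) (countᵇ-false (λ _ → refl) L)

  count-singleton-allVecs : ∀ {n} k (v : Vec (Fin m) k) → countᵇ (singleton v) (allVecs m n k) ≡ 1
  count-singleton-allVecs zero [] = refl
  count-singleton-allVecs {n} (suc k) (x ∷ v) =
    trans (count-singleton-concatMap-∷ x v (allVecs m n k) (allFin m))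
          (cong₂ _*_ (count-≡-allFin x) (count-singleton-allVecs {n} k v))

take-++-drop-take : ∀ {A : Set} (xs : List A) {j k} → j ≤ k → take j xs ++ drop j (take k xs) ≡ take k xs
take-++-drop-take xs {j} {k} j≤k = begin
  take j xs ++ drop j (take k xs)              ≡⟨ cong (_++ drop j (take k xs)) take-j≡take-j-take-k ⟩
  take j (take k xs) ++ drop j (take k xs)     ≡⟨ take++drop≡id j (take k xs) ⟩
  take k xs                                    ∎
  where
  open ≡-Reasoning
  take-j≡take-j-take-k : take j xs ≡ take j (take k xs)
  take-j≡take-j-take-k = sym (trans (take-take j k xs) (cong (λ l → take l xs) (m≤n⇒m⊓n≡m j≤k)))

minimiser : ∀ {t} (f : Fin t → ℕ) → Fin t → ∃ λ k → ∀ k′ → f k ≤ f k′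
minimiser {t} f k = argmin f k (allFin t) , λ k′ → All.lookup (f[argmin]≤f[xs] k (allFin t)) (∈-allFin k′)

last-or-inject₁ : ∀ {t} (k : Fin (suc t)) → k ≡ fromℕ t ⊎ ∃ λ j → k ≡ inject₁ j
last-or-inject₁ {zero}  zero    = inj₁ refl
last-or-inject₁ {suc t} zero    = inj₂ (zero , refl)
last-or-inject₁ {suc t} (suc k) with last-or-inject₁ k
... | inj₁ refl       = inj₁ refl
... | inj₂ (j , refl) = inj₂ (suc j , refl)

cycle-successor : ∀ {t} (k : Fin (suc (suc t))) →
                  ∃ λ k′ → k′ ≢ k × (toℕ k′ ≡ suc (toℕ k) ⊎ toℕ k ≡ suc t × toℕ k′ ≡ 0)
cycle-successor {t} k with last-or-inject₁ k
... | inj₁ refl       = zero , (λ ()) , inj₂ (toℕ-fromℕ (suc t) , refl)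
... | inj₂ (j , refl) = suc j , suc≢inject₁ , inj₁ (cong suc (sym (toℕ-inject₁ j)))
  where
  suc≢inject₁ : suc j ≢ inject₁ j
  suc≢inject₁ 1+j≡j = 1+n≢n (trans (cong toℕ 1+j≡j) (toℕ-inject₁ j))

SucClosed : ∀ {t} → (Fin (suc t) → Set) → Set
SucClosed {t} Q = ∀ (k : Fin t) → Q (inject₁ k) → Q (suc k)

propagate-from-zero : ∀ {t} (Q : Fin (suc t) → Set) → SucClosed Q → Q zero → ∀ k → Q k
propagate-from-zero         Q step Q₀ zero    = Q₀
propagate-from-zero {suc t} Q step Q₀ (suc k) = propagate-from-zero (Q ∘ suc) (λ j → step (suc j)) (step zero Q₀) k

propagate-to-last : ∀ {t} (Q : Fin (suc t) → Set) → SucClosed Q → ∀ k → Q k → Q (fromℕ t)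
propagate-to-last {zero}  Q step zero    Qₖ = Qₖ
propagate-to-last {suc t} Q step zero    Q₀ = propagate-to-last (Q ∘ suc) (λ j → step (suc j)) zero (step zero Q₀)
propagate-to-last {suc t} Q step (suc k) Qₖ = propagate-to-last (Q ∘ suc) (λ j → step (suc j)) k Qₖ

propagate-around-cycle : ∀ {t} (Q : Fin (suc t) → Set) → SucClosed Q → (Q (fromℕ t) → Q zero) →
                         ∀ k → Q k → ∀ k′ → Q k′
propagate-around-cycle Q step wrap k Qₖ = propagate-from-zero Q step (wrap (propagate-to-last Q step k Qₖ))

module _ {m n : ℕ} where

  infix 4 _∈_ _∉_ _⊆_ _covers_
  infixl 6 _∪｛_｝

  _∈_ : Map m n → VSet m n → Set
  _∈_ = _∈ₛ_ m n

  _∉_ : Map m n → VSet m n → Set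
  v ∉ σ = ¬ (v ∈ σ)

  _⊆_ : VSet m n → VSet m n → Set
  _⊆_ = _⊆ₛ_ m n

  _∪｛_｝ : VSet m n → Map m n → VSet m n
  σ ∪｛ v ｝ = insert m n v σ

  ∣_∣ : VSet m n → ℕ
  ∣_∣ = card m n

  _covers_ : VSet m n → VSet m n → Set
  _covers_ = _≻_ m n

  ⟨_⟩ : Fin m → Map m n
  ⟨_⟩ = const⟨_⟩ m n

  ∪｛｝-∈ : ∀ σ v → v ∈ σ ∪｛ v ｝
  ∪｛｝-∈ σ v rewrite dec-true (≡-dec _≟_ v v) refl = ∨-zeroʳ (σ v)

  ⊆-∪｛｝ : ∀ σ v → σ ⊆ σ ∪｛ v ｝
  ⊆-∪｛｝ σ v w w∈σ rewrite w∈σ = refl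

  ∪｛｝-least : ∀ {σ τ v} → σ ⊆ τ → v ∈ τ → σ ∪｛ v ｝ ⊆ τ
  ∪｛｝-least {σ} {v = v} σ⊆τ v∈τ w w∈σ∪v with σ w in w∈σ | ≡-dec _≟_ w v
  ... | true  | _        = σ⊆τ w w∈σ
  ... | false | yes refl = v∈τ
  ... | false | no _     with () ← w∈σ∪v

  ⊆-∪｛｝-∉ : ∀ {σ τ v} → σ ⊆ τ ∪｛ v ｝ → v ∉ σ → σ ⊆ τ
  ⊆-∪｛｝-∉ {σ} {τ} {v} σ⊆τ∪v v∉σ w w∈σ with ≡-dec _≟_ w v | σ⊆τ∪v w w∈σ
  ... | yes refl | _      = ⊥-elim (v∉σ w∈σ)
  ... | no _     | w∈τ∪v = trans (sym (∨-identityʳ (τ w))) w∈τ∪v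

  ∪｛｝-resp-≗ : ∀ {σ τ} v → σ ≗ τ → σ ∪｛ v ｝ ≗ τ ∪｛ v ｝
  ∪｛｝-resp-≗ v σ≗τ w = cong (_∨ singleton v w) (σ≗τ w)

  ⊆-antisym : ∀ {σ τ} → σ ⊆ τ → τ ⊆ σ → σ ≗ τ
  ⊆-antisym {σ} {τ} σ⊆τ τ⊆σ w with σ w in w∈σ | τ w in w∈τ
  ... | true  | true  = refl
  ... | false | false = refl
  ... | true  | false with () ← trans (sym (σ⊆τ w w∈σ)) w∈τ
  ... | false | true  with () ← trans (sym (τ⊆σ w w∈τ)) w∈σ

  ∪｛｝-cancel : ∀ {σ τ v} → v ∉ σ → v ∉ τ → σ ∪｛ v ｝ ≗ τ ∪｛ v ｝ → σ ≗ τ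
  ∪｛｝-cancel {σ} {τ} {v} v∉σ v∉τ σ∪v≗τ∪v = ⊆-antisym
    (⊆-∪｛｝-∉ (λ w w∈σ → trans (sym (σ∪v≗τ∪v w)) (⊆-∪｛｝ σ v w w∈σ)) v∉σ)
    (⊆-∪｛｝-∉ (λ w w∈τ → trans (σ∪v≗τ∪v w) (⊆-∪｛｝ τ v w w∈τ)) v∉τ)

  card-∪｛｝ : ∀ {σ v} → v ∉ σ → ∣ σ ∪｛ v ｝ ∣ ≡ suc ∣ σ ∣
  card-∪｛｝ {σ} {v} v∉σ = begin
    countᵇ (λ w → σ w ∨ singleton v w) (allVecs m n n)          ≡⟨ countᵇ-∨ disjoint (allVecs m n n) ⟩
    ∣ σ ∣ + countᵇ (singleton v) (allVecs m n n)                 ≡⟨ cong (∣ σ ∣ +_) (count-singleton-allVecs {n = n} n v) ⟩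
    ∣ σ ∣ + 1                                                    ≡⟨ +-comm ∣ σ ∣ 1 ⟩
    suc ∣ σ ∣                                                    ∎
    where
    open ≡-Reasoning
    disjoint : ∀ w → σ w ≡ true → singleton v w ≡ false
    disjoint w w∈σ = dec-false (≡-dec _≟_ w v) λ { refl → v∉σ w∈σ }

  card-mono : ∀ {σ τ} → σ ⊆ τ → ∣ σ ∣ ≤ ∣ τ ∣
  card-mono σ⊆τ = countᵇ-mono σ⊆τ (allVecs m n n)

  ⊆∧card≡⇒≗ : ∀ {σ τ} → σ ⊆ τ → ∣ σ ∣ ≡ ∣ τ ∣ → σ ≗ τ
  ⊆∧card≡⇒≗ {σ} {τ} σ⊆τ ∣σ∣≡∣τ∣ = ⊆-antisym σ⊆τ τ⊆σ
    where
    τ⊆σ : τ ⊆ σ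
    τ⊆σ w w∈τ with σ w in w∈σ
    ... | true  = refl
    ... | false = ⊥-elim (n≮n ∣ σ ∣ (begin-strict
      ∣ σ ∣                 <⟨ ≤-reflexive (sym (card-∪｛｝ (not-¬ w∈σ))) ⟩
      ∣ σ ∪｛ w ｝ ∣         ≤⟨ card-mono (∪｛｝-least σ⊆τ w∈τ) ⟩
      ∣ τ ∣                 ≡⟨ sym ∣σ∣≡∣τ∣ ⟩
      ∣ σ ∣                 ∎))
      where open ≤-Reasoning

  ∪｛｝-covers : ∀ {σ v} → v ∉ σ → σ ∪｛ v ｝ covers σ
  ∪｛｝-covers {σ} {v} v∉σ = ⊆-∪｛｝ σ v , card-∪｛｝ v∉σ

  covers-∪｛｝-∉⇒≗ : ∀ {σ τ v} → v ∉ σ → σ ∪｛ v ｝ covers τ → v ∉ τ → τ ≗ σ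
  covers-∪｛｝-∉⇒≗ v∉σ (τ⊆σ∪v , ∣σ∪v∣≡1+∣τ∣) v∉τ =
    ⊆∧card≡⇒≗ (⊆-∪｛｝-∉ τ⊆σ∪v v∉τ) (suc-injective (trans (sym ∣σ∪v∣≡1+∣τ∣) (card-∪｛｝ v∉σ)))

  covers-∪｛｝-exchange : ∀ {σ τ v w} → σ ∪｛ v ｝ covers τ → w ∈ σ → w ∉ τ → τ ∪｛ w ｝ ≗ σ ∪｛ v ｝
  covers-∪｛｝-exchange {σ} {v = v} (τ⊆σ∪v , ∣σ∪v∣≡1+∣τ∣) w∈σ w∉τ =
    ⊆∧card≡⇒≗ (∪｛｝-least τ⊆σ∪v (⊆-∪｛｝ σ v _ w∈σ)) (trans (card-∪｛｝ w∉τ) (sym ∣σ∪v∣≡1+∣τ∣))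

module _ {m n : ℕ} where

  InP-respects : InP m n Respects _≗_
  InP-respects σ≗τ (vertices , (v , v∈σ) , (w , w-vertex , w-adj)) =
      (λ u u∈τ → vertices u (trans (σ≗τ u) u∈τ))
    , (v , trans (sym (σ≗τ v)) v∈σ)
    , (w , w-vertex , λ u u∈τ → w-adj u (trans (σ≗τ u) u∈τ))

  stepS-respects : ∀ {L} x → L Respects _≗_ → stepS m n L x Respects _≗_
  stepS-respects x L-resp σ≗τ (σ∈L , x∉σ , σ∪x∈L) =
    L-resp σ≗τ σ∈L , (λ x∈τ → x∉σ (trans (σ≗τ _) x∈τ)) , L-resp (∪｛｝-resp-≗ ⟨ x ⟩ σ≗τ) σ∪x∈L

  stepS'-respects : ∀ {L} x → L Respects _≗_ → stepS' m n L x Respects _≗_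
  stepS'-respects x L-resp σ≗τ (σ∈L , σ∉S , σ∉μS) =
      L-resp σ≗τ σ∈L
    , (λ τ∈S → σ∉S (stepS-respects x L-resp (λ w → sym (σ≗τ w)) τ∈S))
    , (λ { (ρ , ρ∈S , τ≗ρ∪x) → σ∉μS (ρ , ρ∈S , λ w → trans (σ≗τ w) (τ≗ρ∪x w)) })

  foldl-stepS'-respects : ∀ xs {L} → L Respects _≗_ → foldl (stepS' m n) L xs Respects _≗_
  foldl-stepS'-respects []       L-resp = L-resp
  foldl-stepS'-respects (x ∷ xs) L-resp = foldl-stepS'-respects xs (stepS'-respects x L-resp)

  foldl-stepS'⊆ : ∀ xs {L σ} → foldl (stepS' m n) L xs σ → L σ
  foldl-stepS'⊆ []       σ∈L = σ∈L
  foldl-stepS'⊆ (x ∷ xs) σ∈L = proj₁ (foldl-stepS'⊆ xs σ∈L)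

  -- Layer k is the paper's S'_k, so that Sᵢ m n i is stepS m n (Layer (toℕ i)) i.
  Layer : ℕ → VSet m n → Set
  Layer k = layer m n (take k (allFin m))

  Layer-respects : ∀ k → Layer k Respects _≗_
  Layer-respects k = foldl-stepS'-respects (take k (allFin m)) InP-respects

  Layer⊆InP : ∀ k {σ} → Layer k σ → InP m n σ
  Layer⊆InP k = foldl-stepS'⊆ (take k (allFin m))

  Layer-antitone : ∀ {j k σ} → j ≤ k → Layer k σ → Layer j σ
  Layer-antitone {j} {k} {σ} j≤k σ∈Lₖ =
    foldl-stepS'⊆ (drop j (take k (allFin m)))
      (subst (λ L → L σ) (foldl-++ (stepS' m n) (InP m n) (take j (allFin m)) (drop j (take k (allFin m))))
        (subst (λ xs → layer m n xs σ) (sym (take-++-drop-take (allFin m) j≤k)) σ∈Lₖ))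

  Layer-suc : ∀ i {σ} → Layer (suc (toℕ i)) σ → stepS' m n (Layer (toℕ i)) i σ
  Layer-suc i {σ} σ∈L = subst (λ L → L σ) (foldl-++ (stepS' m n) (InP m n) (take (toℕ i) (allFin m)) (i ∷ []))
                          (subst (λ xs → layer m n xs σ) (take-suc-tabulate id i) σ∈L)

  Layer-beyond : ∀ i {k σ} → toℕ i < k → Layer k σ → stepS' m n (Layer (toℕ i)) i σ
  Layer-beyond i i<k σ∈Lₖ = Layer-suc i (Layer-antitone i<k σ∈Lₖ)

  Sᵢ-removed : ∀ i {k σ τ} → toℕ i < k → Sᵢ m n i σ → τ ≗ σ → ¬ Layer k τ
  Sᵢ-removed i i<k σ∈Sᵢ τ≗σ τ∈Lₖ =
    proj₁ (proj₂ (Layer-beyond i i<k τ∈Lₖ)) (stepS-respects i (Layer-respects (toℕ i)) (λ w → sym (τ≗σ w)) σ∈Sᵢ)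

  μᵢ-removed : ∀ i {k σ τ} → toℕ i < k → Sᵢ m n i σ → τ ≗ σ ∪｛ ⟨ i ⟩ ｝ → ¬ Layer k τ
  μᵢ-removed i {σ = σ} i<k σ∈Sᵢ τ≗μσ τ∈Lₖ = proj₂ (proj₂ (Layer-beyond i i<k τ∈Lₖ)) (σ , σ∈Sᵢ , τ≗μσ)

  S⊆P : (e : SElt m n) → InP m n (set e)
  S⊆P (selt i σ (σ∈Lᵢ , _ , _)) = Layer⊆InP (toℕ i) σ∈Lᵢ

  μ∈P : (e : SElt m n) → InP m n (μ m n e)
  μ∈P (selt i σ (_ , _ , μσ∈Lᵢ)) = Layer⊆InP (toℕ i) μσ∈Lᵢ

  μ-covers : (e : SElt m n) → μ m n e covers set e
  μ-covers (selt i σ (_ , ⟨i⟩∉σ , _)) = ∪｛｝-covers ⟨i⟩∉σ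

  μ∉S : (e : SElt m n) → ¬ InS m n (μ m n e)
  μ∉S (selt i σ σ∈Sᵢ) (j , μσ∈Sⱼ@(μσ∈Lⱼ , ⟨j⟩∉μσ , _)) with <-cmp i j
  ... | tri< i<j _ _  = μᵢ-removed i i<j σ∈Sᵢ (λ _ → refl) μσ∈Lⱼ
  ... | tri≈ _ refl _ = ⟨j⟩∉μσ (∪｛｝-∈ σ ⟨ i ⟩)
  ... | tri> _ _ j<i  = Sᵢ-removed j j<i μσ∈Sⱼ (λ _ → refl) (proj₂ (proj₂ σ∈Sᵢ))

  S-idx-unique : (e e′ : SElt m n) → set e ≗ set e′ → idx e ≡ idx e′
  S-idx-unique (selt i σ σ∈Sᵢ) (selt j τ τ∈Sⱼ) σ≗τ with <-cmp i j
  ... | tri< i<j _ _ = ⊥-elim (Sᵢ-removed i i<j σ∈Sᵢ (λ w → sym (σ≗τ w)) (proj₁ τ∈Sⱼ))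
  ... | tri≈ _ i≡j _ = i≡j
  ... | tri> _ _ j<i = ⊥-elim (Sᵢ-removed j j<i τ∈Sⱼ σ≗τ (proj₁ σ∈Sᵢ))

  μ-injective : (e e′ : SElt m n) → μ m n e ≗ μ m n e′ → set e ≗ set e′
  μ-injective (selt i σ σ∈Sᵢ) (selt j τ τ∈Sⱼ) μσ≗μτ with <-cmp i j
  ... | tri< i<j _ _  = ⊥-elim (μᵢ-removed i i<j σ∈Sᵢ (λ w → sym (μσ≗μτ w)) (proj₂ (proj₂ τ∈Sⱼ)))
  ... | tri≈ _ refl _ = ∪｛｝-cancel (proj₁ (proj₂ σ∈Sᵢ)) (proj₁ (proj₂ τ∈Sⱼ)) μσ≗μτ
  ... | tri> _ _ j<i  = ⊥-elim (μᵢ-removed j j<i τ∈Sⱼ μσ≗μτ (proj₂ (proj₂ σ∈Sᵢ)))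

  μ-isPartialMatching : IsPartialMatching m n
  μ-isPartialMatching = S⊆P , (λ e → μ∈P e , μ∉S e , μ-covers e) , S-idx-unique , μ-injective

module _ {m n : ℕ} where

  μ-covers⇒∈ : (e : SElt m n) {τ : VSet m n} → μ m n e covers τ → ¬ τ ≗ set e → ⟨ idx e ⟩ ∈ τ
  μ-covers⇒∈ (selt i σ (_ , ⟨i⟩∉σ , _)) {τ} μσ≻τ τ≉σ with τ ⟨ i ⟩ in ⟨i⟩∈?τ
  ... | true  = refl
  ... | false = ⊥-elim (τ≉σ (covers-∪｛｝-∉⇒≗ ⟨i⟩∉σ μσ≻τ (not-¬ ⟨i⟩∈?τ)))

  μ-covers-preserves-∈ : ∀ i (e e′ : SElt m n) → toℕ i ≤ toℕ (idx e) → toℕ i ≤ toℕ (idx e′) →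
                         ⟨ i ⟩ ∈ set e → μ m n e covers set e′ → ⟨ i ⟩ ∈ set e′
  μ-covers-preserves-∈ i (selt j σ (_ , ⟨j⟩∉σ , μσ∈Lⱼ)) (selt j′ τ (τ∈Lⱼ′ , _ , _)) i≤j i≤j′ ⟨i⟩∈σ μσ≻τ
    with τ ⟨ i ⟩ in ⟨i⟩∈?τ | m≤n⇒m<n∨m≡n i≤j
  ... | true  | _        = refl
  ... | false | inj₂ i≡j rewrite toℕ-injective i≡j = ⊥-elim (⟨j⟩∉σ ⟨i⟩∈σ)
  ... | false | inj₁ i<j = ⊥-elim (μᵢ-removed i i<j τ∈Sᵢ μσ≗τ∪⟨i⟩ μσ∈Lⱼ)
    where
    ⟨i⟩∉τ : ⟨ i ⟩ ∉ τ
    ⟨i⟩∉τ = not-¬ ⟨i⟩∈?τ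
    μσ≗τ∪⟨i⟩ : σ ∪｛ ⟨ j ⟩ ｝ ≗ τ ∪｛ ⟨ i ⟩ ｝
    μσ≗τ∪⟨i⟩ w = sym (covers-∪｛｝-exchange μσ≻τ ⟨i⟩∈σ ⟨i⟩∉τ w)
    τ∈Sᵢ : Sᵢ m n i τ
    τ∈Sᵢ = Layer-antitone i≤j′ τ∈Lⱼ′ , ⟨i⟩∉τ ,
           Layer-respects (toℕ i) μσ≗τ∪⟨i⟩ (Layer-antitone i≤j μσ∈Lⱼ)

  μ-isAcyclic : IsAcyclic m n
  μ-isAcyclic (suc zero) (s≤s ())
  μ-isAcyclic (suc (suc t)) _ x distinct edge wrap =
    ⟨i⟩∉σ₀ (propagate-around-cycle Q forward wrap′ k₁ Qk₁ k₀)
    where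
    k₀ : Fin (suc (suc t))
    k₀ = proj₁ (minimiser (toℕ ∘ idx ∘ x) zero)

    k₀-minimal : ∀ k → toℕ (idx (x k₀)) ≤ toℕ (idx (x k))
    k₀-minimal = proj₂ (minimiser (toℕ ∘ idx ∘ x) zero)

    i : Fin m
    i = idx (x k₀)

    ⟨i⟩∉σ₀ : ⟨ i ⟩ ∉ set (x k₀)
    ⟨i⟩∉σ₀ = proj₁ (proj₂ (isS (x k₀)))

    Q : Fin (suc (suc t)) → Set
    Q k = ⟨ i ⟩ ∈ set (x k)

    preserve : ∀ {k k′} → μ m n (x k) covers set (x k′) → Q k → Q k′
    preserve {k} {k′} μxₖ≻xₖ′ Qₖ = μ-covers-preserves-∈ i (x k) (x k′) (k₀-minimal k) (k₀-minimal k′) Qₖ μxₖ≻xₖ′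

    forward : SucClosed Q
    forward j = preserve (edge (inject₁ j) (suc j) (cong suc (sym (toℕ-inject₁ j))))

    wrap′ : Q (fromℕ (suc t)) → Q zero
    wrap′ = preserve (wrap (fromℕ (suc t)) zero (toℕ-fromℕ (suc t)) refl)

    k₁ : Fin (suc (suc t))
    k₁ = proj₁ (cycle-successor k₀)

    μx₀≻x₁ : μ m n (x k₀) covers set (x k₁)
    μx₀≻x₁ = [ edge k₀ k₁ , uncurry (wrap k₀ k₁) ]′ (proj₂ (proj₂ (cycle-successor k₀)))

    Qk₁ : Q k₁
    Qk₁ = μ-covers⇒∈ (x k₀) μx₀≻x₁ (distinct k₁ k₀ (proj₁ (proj₂ (cycle-successor k₀))))

proposition4p2 : (m n : ℕ) → 3 ≤ n → n < m →
    IsPartialMatching m n × IsAcyclic m n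
proposition4p2 m n _ _ = μ-isPartialMatching , μ-isAcyclic
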